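{- Let $K_6(x) = x^6 + (1-x)^6 + 1 = 2x^6 - 6x^5 + 15x^4 - 20x^3 + 15x^2 - 6x + 2$ and let $p$ be an odd prime. If $K_6$ has a root in $\mathbb{F}_p$, then $K_6$ splits into linear factors over $\mathbb{F}_p$. Furthermore, the roots of $K_6$ in $\mathbb{F}_p$ lie in $\mathbb{F}_p\setminus\{0,1\}$, and for any two roots $\alpha, \beta \in \mathbb{F}_p$ of $K_6$ there is a transformation $h$ in $H = \{x\mapsto x,\ x \mapsto 1-x,\ x\mapsto \frac1x,\ x\mapsto \frac{x}{x-1},\ x \mapsto \frac{1}{1-x},\ x\mapsto \frac{x-1}{x}\}$ with $h(\alpha) = \beta$ (i.e. $H$ acts transitively on the roots of $K_6$ in $\mathbb{F}_p$). -}

module Defs where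

open import Data.Nat using (ℕ; zero; suc)
open import Data.Integer using (ℤ; +_; _+_; _-_; _*_; -_)
open import Data.Integer.Divisibility using (_∣_)
open import Data.List using (List; []; _∷_)
open import Data.Vec using (Vec; foldr)
open import Data.Product using (_×_)
open import Data.Unit using (⊤)

infix 4 _≡[_]_
_≡[_]_ : ℤ → ℕ → ℤ → Set
a ≡[ p ] b = (+ p) ∣ (a - b)

-- Polynomials with integer coefficients, as lists of coefficients
-- in ascending order of degree (constant term first).
Poly : Set
Poly = List ℤ

polyAdd : Poly → Poly → Poly
polyAdd [] q = q
polyAdd (a ∷ p) [] = a ∷ p
polyAdd (a ∷ p) (b ∷ q) = (a + b) ∷ polyAdd p q

polyScale : ℤ → Poly → Poly
polyScale c [] = []
polyScale c (a ∷ p) = (c * a) ∷ polyScale c p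

polyMul : Poly → Poly → Poly
polyMul [] q = []
polyMul (a ∷ p) q = polyAdd (polyScale a q) (+ 0 ∷ polyMul p q)

polyPow : Poly → ℕ → Poly
polyPow f zero = + 1 ∷ []
polyPow f (suc n) = polyMul f (polyPow f n)

eval : Poly → ℤ → ℤ
eval [] x = + 0
eval (a ∷ p) x = a + x * eval p x

-- Equality of polynomials over F_p: coefficientwise congruence mod p
-- (missing coefficients count as 0).
PolyEqMod : ℕ → Poly → Poly → Set
PolyEqMod p [] [] = ⊤
PolyEqMod p (a ∷ f) [] = (a ≡[ p ] + 0) × PolyEqMod p f []
PolyEqMod p [] (b ∷ g) = (+ 0 ≡[ p ] b) × PolyEqMod p [] g
PolyEqMod p (a ∷ f) (b ∷ g) = (a ≡[ p ] b) × PolyEqMod p f g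

X : Poly
X = + 0 ∷ + 1 ∷ []

C : ℤ → Poly
C c = c ∷ []

K6 : Poly
K6 = polyAdd (polyPow X 6) (polyAdd (polyPow (+ 1 ∷ - + 1 ∷ []) 6) (C (+ 1)))

linFactor : ℤ → Poly
linFactor a = (- a) ∷ + 1 ∷ []

scaledProd : ∀ {n} → ℤ → Vec ℤ n → Poly
scaledProd c as = foldr (λ _ → Poly) (λ a acc → polyMul (linFactor a) acc) (C c) as

data H : Set where
  hId hOneMinus hInv hXOverXm1 hOneOverOneMinus hXm1OverX : H

-- Applies h α β : "h(α) = β in F_p". Division is expressed via its
-- defining property in the field F_p: β = u / v  ⇔  β · v = u
-- (for v ≠ 0 in F_p, which holds for the relevant α ∉ {0,1}).
Applies : ℕ → H → ℤ → ℤ → Set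
Applies p hId α β = β ≡[ p ] α
Applies p hOneMinus α β = β ≡[ p ] (+ 1 - α)
Applies p hInv α β = (β * α) ≡[ p ] + 1
Applies p hXOverXm1 α β = (β * (α - + 1)) ≡[ p ] α
Applies p hOneOverOneMinus α β = (β * (+ 1 - α)) ≡[ p ] + 1
Applies p hXm1OverX α β = (β * α) ≡[ p ] (α - + 1)

module Submission where

-- Write s(x) = x(1 - x), so that K₆(x) = 2 - 6s + 9s² - 2s³ = 2y³ + 9y² + 6y + 2 with y = x² - x.
-- As K₆(0) = K₆(1) = 2, a root t modulo an odd prime p is a unit, and so is u = 1 - t. Its H-orbit
-- t, 1 - t, 1/t, 1 - 1/t, 1/u, 1 - 1/u splits into pairs {r, 1 - r} with (x - r)(x - (1 - r)) = y + s(r),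
-- and the three values s(t) = tu, s(1/t) = -u/t², s(1/u) = -t/u² have σ₃ = 1, σ₂ = 3 and
-- 2σ₁ = 9 - K₆(t)/(tu)², so twice the product of the x - r over the orbit is K₆.
-- Transitivity: K₆(x)/(x(x - 1))² is H-invariant, which with denominators cleared reads
-- (β(β - 1))² K₆(α) - (α(α - 1))² K₆(β) = 2 ∏_{h ∈ H} (β - h(α)); for two roots p divides one factor.

open import Defs
open import Data.Nat using (ℕ; suc)
import Data.Nat as ℕ
open import Data.Nat.Divisibility using (∣1⇒≡1) renaming (_∣_ to _∣ℕ_)
open import Data.Nat.Primality using (Prime; euclidsLemma; prime⇒irreducible; ¬prime[1]; irreducible[2])
open import Data.Nat.Coprimality using (Coprime; coprime-Bézout)
open import Data.Nat.GCD using (module Bézout)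
open import Data.Integer using (ℤ; +_; -[1+_]; _-_; _+_; _*_; -_; ∣_∣)
open import Data.Integer.Divisibility using (_∣_)
open import Data.Integer.Properties using (*-assoc; +-inverseʳ; +-identityʳ; abs-*; pos-+; pos-*)
import Data.Integer.Divisibility.Signed as Signed
open import Data.Integer.Tactic.RingSolver using (solve-∀; solve)
open import Data.List using (List; []; _∷_; foldr; map)
open import Data.List.Relation.Unary.Any using (Any; here; there; satisfied)
open import Data.List.Relation.Unary.Any.Properties using (map⁻)
open import Data.Sum using (_⊎_; inj₁; inj₂)
open import Function using (_∘_)
open import Data.Vec as Vec using (Vec)
open import Data.Product using (_×_; _,_; ∃-syntax)
open import Data.Unit using (tt)
open import Level using (0ℓ)
open import Relation.Nullary using (¬_; contradiction)
open import Relation.Binary using (Setoid)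
open import Relation.Binary.PropositionalEquality using (_≡_; _≢_; refl; sym; subst; subst₂; cong; cong₂; module ≡-Reasoning)
import Relation.Binary.Reasoning.Setoid as SetoidReasoning

module Modulo (n : ℕ) where

  -- _≡[ n ]_ unfolds to divisibility of a - b, from which unification cannot recover a and b;
  -- this record wrapper keeps them as indices.
  infix 4 _≈_
  record _≈_ (a b : ℤ) : Set where
    constructor ≡[]⇒≈
    field ≈⇒≡[] : a ≡[ n ] b
  open _≈_ public

  ≈-by-multiple : ∀ {x y} (q : ℤ) → x - y ≡ q * + n → x ≈ y
  ≈-by-multiple q eq = ≡[]⇒≈ (Signed.∣⇒∣ᵤ (Signed.divides q eq))

  private
    multiple : ∀ {r s} → r ≈ s → ∃[ q ] r - s ≡ q * + n
    multiple {r} {s} (≡[]⇒≈ r≡s) with Signed.divides q eq ← Signed.∣ᵤ⇒∣ {+ n} {r - s} r≡s = q , eq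

  ≈-lincomb : ∀ {r s x y} → r ≈ s → (c : ℤ) → x - y ≡ c * (r - s) → x ≈ y
  ≈-lincomb {r} {s} {x} {y} r≈s c eq with q , r-s≡qn ← multiple r≈s = ≈-by-multiple (c * q) (begin
    x - y         ≡⟨ eq ⟩
    c * (r - s)   ≡⟨ cong (c *_) r-s≡qn ⟩
    c * (q * + n) ≡⟨ *-assoc c q (+ n) ⟨
    c * q * + n   ∎)
    where open ≡-Reasoning

  ≈-lincomb₂ : ∀ {r s r′ s′ x y} → r ≈ s → r′ ≈ s′ → (c c′ : ℤ) →
               x - y ≡ c * (r - s) + c′ * (r′ - s′) → x ≈ y
  ≈-lincomb₂ {r} {s} {r′} {s′} {x} {y} r≈s r′≈s′ c c′ eq
    with q , r-s≡qn ← multiple r≈s | q′ , r′-s′≡q′n ← multiple r′≈s′ =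
    ≈-by-multiple (c * q + c′ * q′) (begin
      x - y                             ≡⟨ eq ⟩
      c * (r - s) + c′ * (r′ - s′)      ≡⟨ cong₂ (λ u v → c * u + c′ * v) r-s≡qn r′-s′≡q′n ⟩
      c * (q * + n) + c′ * (q′ * + n)   ≡⟨ factor c q c′ q′ (+ n) ⟩
      (c * q + c′ * q′) * + n           ∎)
    where
    open ≡-Reasoning
    factor : ∀ c q c′ q′ m → c * (q * m) + c′ * (q′ * m) ≡ (c * q + c′ * q′) * m
    factor = solve-∀

  ≈-reflexive : ∀ {a b} → a ≡ b → a ≈ b
  ≈-reflexive {a} refl = ≈-by-multiple (+ 0) (+-inverseʳ a)

  ≈-refl : ∀ {a} → a ≈ a
  ≈-refl = ≈-reflexive refl

  ≈-sym : ∀ {a b} → a ≈ b → b ≈ a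
  ≈-sym {a} {b} a≈b = ≈-lincomb a≈b (- + 1) (solve (a ∷ b ∷ []))

  ≈-trans : ∀ {a b c} → a ≈ b → b ≈ c → a ≈ c
  ≈-trans {a} {b} {c} a≈b b≈c = ≈-lincomb₂ a≈b b≈c (+ 1) (+ 1) (solve (a ∷ b ∷ c ∷ []))

  ≈-setoid : Setoid 0ℓ 0ℓ
  ≈-setoid = record
    { Carrier = ℤ
    ; _≈_ = _≈_
    ; isEquivalence = record { refl = ≈-refl ; sym = ≈-sym ; trans = ≈-trans }
    }

  module ≈-Reasoning = SetoidReasoning ≈-setoid

  +-cong : ∀ {a b c d} → a ≈ b → c ≈ d → a + c ≈ b + d
  +-cong {a} {b} {c} {d} a≈b c≈d = ≈-lincomb₂ a≈b c≈d (+ 1) (+ 1) (solve (a ∷ b ∷ c ∷ d ∷ []))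

  *-cong : ∀ {a b c d} → a ≈ b → c ≈ d → a * c ≈ b * d
  *-cong {a} {b} {c} {d} a≈b c≈d = ≈-lincomb₂ a≈b c≈d c b (solve (a ∷ b ∷ c ∷ d ∷ []))

  +-congˡ : ∀ a {b c} → b ≈ c → a + b ≈ a + c
  +-congˡ a = +-cong (≈-refl {a})

  *-congˡ : ∀ a {b c} → b ≈ c → a * b ≈ a * c
  *-congˡ a = *-cong (≈-refl {a})

  *-congʳ : ∀ a {b c} → b ≈ c → b * a ≈ c * a
  *-congʳ a b≈c = *-cong b≈c (≈-refl {a})

  -‿cong : ∀ {a b} → a ≈ b → - a ≈ - b
  -‿cong {a} {b} a≈b = ≈-lincomb a≈b (- + 1) (solve (a ∷ b ∷ []))

  eval-cong : ∀ f {a b} → a ≈ b → eval f a ≈ eval f b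
  eval-cong []      a≈b = ≈-refl
  eval-cong (c ∷ f) a≈b = +-congˡ c (*-cong a≈b (eval-cong f a≈b))

  eval-root-cong : ∀ f {a b} → eval f a ≈ + 0 → a ≈ b → eval f b ≈ + 0
  eval-root-cong f fa≈0 a≈b = ≈-trans (≈-sym (eval-cong f a≈b)) fa≈0

  ≈0⇒∣ : ∀ {x} → x ≈ + 0 → + n ∣ x
  ≈0⇒∣ {x} (≡[]⇒≈ n∣x-0) = subst (λ y → + n ∣ y) (+-identityʳ x) n∣x-0

  ≈-cancel-unit : ∀ {u v a b} → u * v ≈ + 1 → v * a ≈ v * b → a ≈ b
  ≈-cancel-unit {u} {v} {a} {b} uv≈1 va≈vb = begin
    a             ≡⟨ solve (a ∷ []) ⟩
    + 1 * a       ≈⟨ *-congʳ a uv≈1 ⟨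
    u * v * a     ≡⟨ *-assoc u v a ⟩
    u * (v * a)   ≈⟨ *-congˡ u va≈vb ⟩
    u * (v * b)   ≡⟨ *-assoc u v b ⟨
    u * v * b     ≈⟨ *-congʳ b uv≈1 ⟩
    + 1 * b       ≡⟨ solve (b ∷ []) ⟩
    b             ∎
    where open ≈-Reasoning

∏ : List ℤ → ℤ
∏ = foldr _*_ (+ 1)

module _ {p : ℕ} (p-prime : Prime p) where
  open Modulo p

  prime-∣-* : ∀ x y → + p ∣ x * y → (+ p ∣ x) ⊎ (+ p ∣ y)
  prime-∣-* x y p∣xy = euclidsLemma ∣ x ∣ ∣ y ∣ p-prime (subst (p ∣ℕ_) (abs-* x y) p∣xy)

  prime∤1 : ¬ p ∣ℕ 1
  prime∤1 p∣1 = ¬prime[1] (subst Prime (∣1⇒≡1 p∣1) p-prime)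

  prime-∣-∏ : ∀ xs → + p ∣ ∏ xs → Any (+ p ∣_) xs
  prime-∣-∏ []       p∣1  = contradiction p∣1 prime∤1
  prime-∣-∏ (x ∷ xs) p∣∏ with prime-∣-* x (∏ xs) p∣∏
  ... | inj₁ p∣x   = here p∣x
  ... | inj₂ p∣∏xs = there (prime-∣-∏ xs p∣∏xs)

  ∣⇒≈0 : ∀ {x} → + p ∣ x → x ≈ + 0
  ∣⇒≈0 {x} p∣x with Signed.divides q x≡qp ← Signed.∣ᵤ⇒∣ {+ p} {x} p∣x =
    ≈-by-multiple q (subst (_≡ q * + p) (sym (+-identityʳ x)) x≡qp)

  private
    coprime : ∀ {m} → ¬ p ∣ℕ m → Coprime p m
    coprime p∤m (d∣p , d∣m) with prime⇒irreducible p-prime d∣p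
    ... | inj₁ d≡1 = d≡1
    ... | inj₂ refl = contradiction d∣m p∤m

    pos-1+* : ∀ a b c d → 1 ℕ.+ a ℕ.* b ≡ c ℕ.* d → + 1 + + a * + b ≡ + c * + d
    pos-1+* a b c d eq = begin
      + 1 + + a * + b    ≡⟨ cong (_+_ (+ 1)) (pos-* a b) ⟨
      + 1 + + (a ℕ.* b)  ≡⟨ pos-+ 1 (a ℕ.* b) ⟨
      + (1 ℕ.+ a ℕ.* b)  ≡⟨ cong +_ eq ⟩
      + (c ℕ.* d)        ≡⟨ pos-* c d ⟩
      + c * + d          ∎
      where open ≡-Reasoning

    ∃-inverse-ℕ : ∀ {m} → ¬ p ∣ℕ m → ∃[ y ] y * + m ≈ + 1
    ∃-inverse-ℕ {m} p∤m with coprime-Bézout (coprime p∤m)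
    ... | Bézout.+- a b 1+bm≡ap = - + b , ≈-by-multiple (- + a) (rearrange (+ b) (+ m) (+ a) (+ p) (pos-1+* b m a p 1+bm≡ap))
      where
      rearrange : ∀ b m a p → + 1 + b * m ≡ a * p → (- b) * m - + 1 ≡ (- a) * p
      rearrange b m a p eq = begin
        (- b) * m - + 1   ≡⟨ solve (b ∷ m ∷ []) ⟩
        - (+ 1 + b * m)   ≡⟨ cong -_ eq ⟩
        - (a * p)         ≡⟨ solve (a ∷ p ∷ []) ⟩
        (- a) * p         ∎
        where open ≡-Reasoning
    ... | Bézout.-+ a b 1+ap≡bm = + b , ≈-by-multiple (+ a) (rearrange (+ b) (+ m) (+ a) (+ p) (pos-1+* a p b m 1+ap≡bm))
      where
      rearrange : ∀ b m a p → + 1 + a * p ≡ b * m → b * m - + 1 ≡ a * p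
      rearrange b m a p eq = begin
        b * m - + 1          ≡⟨ cong (_- + 1) eq ⟨
        + 1 + a * p - + 1    ≡⟨ solve (a ∷ p ∷ []) ⟩
        a * p                ∎
        where open ≡-Reasoning

  ∃-inverse : ∀ {x} → ¬ x ≈ + 0 → ∃[ y ] y * x ≈ + 1
  ∃-inverse {+ m}        x≉0 = ∃-inverse-ℕ (x≉0 ∘ ∣⇒≈0)
  ∃-inverse { -[1+ m ] } x≉0 with y , y*m≈1 ← ∃-inverse-ℕ (x≉0 ∘ ∣⇒≈0) =
    - y , ≈-trans (≈-reflexive (neg*neg y (+ suc m))) y*m≈1
    where
    neg*neg : ∀ y x → (- y) * (- x) ≡ y * x
    neg*neg = solve-∀

K₆ₛ : ℤ → ℤ
K₆ₛ s = + 2 - + 6 * s + + 9 * s * s - + 2 * s * s * s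

eval-K6 : ∀ x → eval K6 x ≡ K₆ₛ (x * (+ 1 - x))
eval-K6 x = begin
  eval K6 x
    ≡⟨⟩
  + 2 + x * (- + 6 + x * (+ 15 + x * (- + 20 + x * (+ 15 + x * (- + 6 + x * (+ 2 + x * + 0))))))
    ≡⟨ solve (x ∷ []) ⟩
  + 2 - + 6 * (x * (+ 1 - x)) + + 9 * (x * (+ 1 - x)) * (x * (+ 1 - x))
    - + 2 * (x * (+ 1 - x)) * (x * (+ 1 - x)) * (x * (+ 1 - x))
    ∎
  where open ≡-Reasoning

-- c₃ y³ + c₂ y² + c₁ y + c₀ with y = x² - x, as a coefficient list
cubicIn[x²-x] : ℤ → ℤ → ℤ → ℤ → Poly
cubicIn[x²-x] c₃ c₂ c₁ c₀ =
  c₀ ∷ - c₁ ∷ c₁ + c₂ ∷ - c₃ - + 2 * c₂ ∷ + 3 * c₃ + c₂ ∷ - (+ 3 * c₃) ∷ c₃ ∷ []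

K6-as-cubic : K6 ≡ cubicIn[x²-x] (+ 2) (+ 9) (+ 6) (+ 2)
K6-as-cubic = refl

complementPairs : ℤ → ℤ → ℤ → Vec ℤ 6
complementPairs a b d = a Vec.∷ + 1 - a Vec.∷ b Vec.∷ + 1 - b Vec.∷ d Vec.∷ + 1 - d Vec.∷ Vec.[]

scaledProd-complementPairs : ∀ c a b d →
  scaledProd c (complementPairs a b d)
    ≡ cubicIn[x²-x] c
        (c * (a * (+ 1 - a) + b * (+ 1 - b) + d * (+ 1 - d)))
        (c * (a * (+ 1 - a) * (b * (+ 1 - b)) + a * (+ 1 - a) * (d * (+ 1 - d)) + b * (+ 1 - b) * (d * (+ 1 - d))))
        (c * (a * (+ 1 - a) * (b * (+ 1 - b)) * (d * (+ 1 - d))))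
scaledProd-complementPairs c a b d =
  cong₂ _∷_ (solve (c ∷ a ∷ b ∷ d ∷ [])) (cong₂ _∷_ (solve (c ∷ a ∷ b ∷ d ∷ []))
  (cong₂ _∷_ (solve (c ∷ a ∷ b ∷ d ∷ [])) (cong₂ _∷_ (solve (c ∷ a ∷ b ∷ d ∷ []))
  (cong₂ _∷_ (solve (c ∷ a ∷ b ∷ d ∷ [])) (cong₂ _∷_ (solve (c ∷ a ∷ b ∷ d ∷ []))
  (cong₂ _∷_ (solve (c ∷ a ∷ b ∷ d ∷ [])) refl))))))

module _ {n : ℕ} where
  open Modulo n

  cubicIn[x²-x]-cong : ∀ {c₃ c₂ c₁ c₀ d₃ d₂ d₁ d₀} → c₃ ≈ d₃ → c₂ ≈ d₂ → c₁ ≈ d₁ → c₀ ≈ d₀ →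
                       PolyEqMod n (cubicIn[x²-x] c₃ c₂ c₁ c₀) (cubicIn[x²-x] d₃ d₂ d₁ d₀)
  cubicIn[x²-x]-cong c₃≈d₃ c₂≈d₂ c₁≈d₁ c₀≈d₀ =
    ≈⇒≡[] c₀≈d₀ , ≈⇒≡[] (-‿cong c₁≈d₁) , ≈⇒≡[] (+-cong c₁≈d₁ c₂≈d₂) ,
    ≈⇒≡[] (+-cong (-‿cong c₃≈d₃) (-‿cong (*-congˡ (+ 2) c₂≈d₂))) ,
    ≈⇒≡[] (+-cong (*-congˡ (+ 3) c₃≈d₃) c₂≈d₂) , ≈⇒≡[] (-‿cong (*-congˡ (+ 3) c₃≈d₃)) , ≈⇒≡[] c₃≈d₃ , tt

  s-of-inverse : ∀ t u i → t + u ≈ + 1 → i * t ≈ + 1 → t * t * (i * (+ 1 - i)) ≈ - u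
  s-of-inverse t u i t+u≈1 it≈1 =
    ≈-lincomb₂ it≈1 t+u≈1 (t - i * t - + 1) (+ 1) (solve (t ∷ u ∷ i ∷ []))

  -- Over a field the hypotheses say a = -u/t² and b = -t/u², i.e. a = s(1/t) and b = s(1/u).
  module SymmetricFunctions (t u a b w : ℤ) (t+u≈1 : t + u ≈ + 1)
    (t²a≈-u : t * t * a ≈ - u) (u²b≈-t : u * u * b ≈ - t) (tu-unit : w * (t * u) ≈ + 1) where

    open ≈-Reasoning

    cancel-s : ∀ {x y} → t * u * x ≈ t * u * y → x ≈ y
    cancel-s = ≈-cancel-unit {w} {t * u} tu-unit

    σ₃≈1 : t * u * a * b ≈ + 1
    σ₃≈1 = cancel-s (begin
      t * u * (t * u * a * b)   ≡⟨ solve (t ∷ u ∷ a ∷ b ∷ []) ⟩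
      t * t * a * (u * u * b)   ≈⟨ *-cong t²a≈-u u²b≈-t ⟩
      - u * - t                 ≡⟨ solve (t ∷ u ∷ []) ⟩
      t * u * + 1               ∎)

    σ₂≈3 : t * u * a + t * u * b + a * b ≈ + 3
    σ₂≈3 = cancel-s (cancel-s (begin
      t * u * (t * u * (t * u * a + t * u * b + a * b))
        ≡⟨ solve (t ∷ u ∷ a ∷ b ∷ []) ⟩
      t * u * (u * u) * (t * t * a) + t * u * (t * t) * (u * u * b) + t * t * a * (u * u * b)
        ≈⟨ +-cong (+-cong (*-congˡ (t * u * (u * u)) t²a≈-u) (*-congˡ (t * u * (t * t)) u²b≈-t))
                  (*-cong t²a≈-u u²b≈-t) ⟩
      t * u * (u * u) * - u + t * u * (t * t) * - t + - u * - t
        ≈⟨ ≈-lincomb t+u≈1 (t * u * (+ 3 * t * u - + 1 - (t + u) - (t + u) * (t + u))) (solve (t ∷ u ∷ [])) ⟩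
      t * u * (t * u * + 3)
        ∎))

    2σ₁≈9 : K₆ₛ (t * u) ≈ + 0 → + 2 * (t * u + a + b) ≈ + 9
    2σ₁≈9 K≈0 = cancel-s (cancel-s (begin
      t * u * (t * u * (+ 2 * (t * u + a + b)))
        ≡⟨ solve (t ∷ u ∷ a ∷ b ∷ []) ⟩
      + 2 * (t * u * (t * u) * (t * u)) + + 2 * (u * u) * (t * t * a) + + 2 * (t * t) * (u * u * b)
        ≈⟨ +-cong (+-congˡ (+ 2 * (t * u * (t * u) * (t * u))) (*-congˡ (+ 2 * (u * u)) t²a≈-u))
                  (*-congˡ (+ 2 * (t * t)) u²b≈-t) ⟩
      + 2 * (t * u * (t * u) * (t * u)) + + 2 * (u * u) * - u + + 2 * (t * t) * - t
        ≈⟨ ≈-lincomb₂ t+u≈1 K≈0 (+ 2 * (+ 3 * t * u - + 1 - (t + u) - (t + u) * (t + u))) (- + 1) (certificate t u) ⟩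
      t * u * (t * u * + 9)
        ∎))
      where
      certificate : ∀ t u →
        + 2 * (t * u * (t * u) * (t * u)) + + 2 * (u * u) * - u + + 2 * (t * t) * - t - t * u * (t * u * + 9)
          ≡ + 2 * (+ 3 * t * u - + 1 - (t + u) - (t + u) * (t + u)) * ((t + u) - + 1)
            + (- + 1) * (+ 2 - + 6 * (t * u) + + 9 * (t * u) * (t * u) - + 2 * (t * u) * (t * u) * (t * u) - + 0)
      certificate = solve-∀

transformations : List H
transformations = hId ∷ hOneMinus ∷ hInv ∷ hXOverXm1 ∷ hOneOverOneMinus ∷ hXm1OverX ∷ []

defect : H → ℤ → ℤ → ℤ
defect hId              α β = β - α
defect hOneMinus        α β = β - (+ 1 - α)
defect hInv             α β = β * α - + 1
defect hXOverXm1        α β = β * (α - + 1) - α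
defect hOneOverOneMinus α β = β * (+ 1 - α) - + 1
defect hXm1OverX        α β = β * α - (α - + 1)

defect⇒Applies : ∀ {p} h {α β} → + p ∣ defect h α β → Applies p h α β
defect⇒Applies hId              d = d
defect⇒Applies hOneMinus        d = d
defect⇒Applies hInv             d = d
defect⇒Applies hXOverXm1        d = d
defect⇒Applies hOneOverOneMinus d = d
defect⇒Applies hXm1OverX        d = d

defects : ℤ → ℤ → List ℤ
defects α β = map (λ h → defect h α β) transformations

orbit-invariance : ∀ α β →
  β * (β - + 1) * (β * (β - + 1)) * eval K6 α - α * (α - + 1) * (α * (α - + 1)) * eval K6 β
    ≡ + 2 * ∏ (defects α β)
orbit-invariance α β = begin
  β * (β - + 1) * (β * (β - + 1))
    * (+ 2 + α * (- + 6 + α * (+ 15 + α * (- + 20 + α * (+ 15 + α * (- + 6 + α * (+ 2 + α * + 0)))))))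
  - α * (α - + 1) * (α * (α - + 1))
    * (+ 2 + β * (- + 6 + β * (+ 15 + β * (- + 20 + β * (+ 15 + β * (- + 6 + β * (+ 2 + β * + 0)))))))
    ≡⟨ solve (α ∷ β ∷ []) ⟩
  + 2 * ((β - α) * ((β - (+ 1 - α)) * ((β * α - + 1) * ((β * (α - + 1) - α)
      * ((β * (+ 1 - α) - + 1) * ((β * α - (α - + 1)) * + 1))))))
    ∎
  where open ≡-Reasoning

module _ {p : ℕ} (p-prime : Prime p) (p≢2 : p ≢ 2) where
  open Modulo p

  odd-prime∤2 : ¬ p ∣ℕ 2
  odd-prime∤2 p∣2 with irreducible[2] p∣2
  ... | inj₁ p≡1 = ¬prime[1] (subst Prime p≡1 p-prime)
  ... | inj₂ p≡2 = p≢2 p≡2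

  -- eval K6 (+ 0) and eval K6 (+ 1) both compute to + 2.
  K6-root-≉0 : ∀ α → eval K6 α ≈ + 0 → ¬ α ≈ + 0
  K6-root-≉0 α Kα≈0 α≈0 = odd-prime∤2 (≈⇒≡[] (eval-root-cong K6 Kα≈0 α≈0))

  K6-root-≉1 : ∀ α → eval K6 α ≈ + 0 → ¬ α ≈ + 1
  K6-root-≉1 α Kα≈0 α≈1 = odd-prime∤2 (≈⇒≡[] (eval-root-cong K6 Kα≈0 α≈1))

  K6-roots-2∏≈0 : ∀ α β → eval K6 α ≈ + 0 → eval K6 β ≈ + 0 → + 2 * ∏ (defects α β) ≈ + 0
  K6-roots-2∏≈0 α β Kα≈0 Kβ≈0 =
    ≈-trans (≈-reflexive (sym (orbit-invariance α β)))
            (≈-lincomb₂ Kα≈0 Kβ≈0 (β * (β - + 1) * (β * (β - + 1))) (- (α * (α - + 1) * (α * (α - + 1))))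
                        (rearrange (β * (β - + 1) * (β * (β - + 1))) (α * (α - + 1) * (α * (α - + 1)))
                                   (eval K6 α) (eval K6 β)))
    where
    rearrange : ∀ A B a b → A * a - B * b - + 0 ≡ A * (a - + 0) + (- B) * (b - + 0)
    rearrange = solve-∀

  K6-roots-related : ∀ α β → eval K6 α ≈ + 0 → eval K6 β ≈ + 0 → ∃[ h ] Applies p h α β
  K6-roots-related α β Kα≈0 Kβ≈0 =
    some-factor (prime-∣-* p-prime (+ 2) (∏ (defects α β)) (≈0⇒∣ (K6-roots-2∏≈0 α β Kα≈0 Kβ≈0)))
    where
    some-factor : (+ p ∣ + 2) ⊎ (+ p ∣ ∏ (defects α β)) → ∃[ h ] Applies p h α β
    some-factor (inj₁ p∣2) = contradiction p∣2 odd-prime∤2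
    some-factor (inj₂ p∣∏)
      with h , p∣defect ← satisfied (map⁻ {f = λ h → defect h α β} {xs = transformations}
                                          (prime-∣-∏ p-prime (defects α β) p∣∏)) =
      h , defect⇒Applies h p∣defect

  K6-splits : ∀ t → eval K6 t ≈ + 0 → ∃[ as ] PolyEqMod p K6 (scaledProd (+ 2) as)
  K6-splits t Kt≈0 = orbit (∃-inverse p-prime (K6-root-≉0 t Kt≈0)) (∃-inverse p-prime 1-t≉0)
    where
    1-t≉0 : ¬ + 1 - t ≈ + 0
    1-t≉0 1-t≈0 = K6-root-≉1 t Kt≈0 (≈-lincomb 1-t≈0 (- + 1) (solve (t ∷ [])))

    orbit : ∃[ i ] i * t ≈ + 1 → ∃[ k ] k * (+ 1 - t) ≈ + 1 → ∃[ as ] PolyEqMod p K6 (scaledProd (+ 2) as)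
    orbit (i , it≈1) (k , ku≈1) =
      complementPairs t i k ,
      subst₂ (PolyEqMod p) (sym K6-as-cubic) (sym (scaledProd-complementPairs (+ 2) t i k))
        (cubicIn[x²-x]-cong (≈-refl {+ 2}) (≈-sym (2σ₁≈9 Ks≈0))
                            (≈-sym (*-congˡ (+ 2) σ₂≈3)) (≈-sym (*-congˡ (+ 2) σ₃≈1)))
      where
      Ks≈0 : K₆ₛ (t * (+ 1 - t)) ≈ + 0
      Ks≈0 = ≈-trans (≈-reflexive (sym (eval-K6 t))) Kt≈0
      t+u≈1 : t + (+ 1 - t) ≈ + 1
      t+u≈1 = ≈-reflexive (solve (t ∷ []))
      u+t≈1 : + 1 - t + t ≈ + 1
      u+t≈1 = ≈-reflexive (solve (t ∷ []))
      tu-unit : i * k * (t * (+ 1 - t)) ≈ + 1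
      tu-unit = begin
        i * k * (t * (+ 1 - t))   ≡⟨ solve (t ∷ i ∷ k ∷ []) ⟩
        i * t * (k * (+ 1 - t))   ≈⟨ *-cong it≈1 ku≈1 ⟩
        + 1                       ∎
        where open ≈-Reasoning
      open SymmetricFunctions t (+ 1 - t) (i * (+ 1 - i)) (k * (+ 1 - k)) (i * k)
             t+u≈1 (s-of-inverse t (+ 1 - t) i t+u≈1 it≈1) (s-of-inverse (+ 1 - t) t k u+t≈1 ku≈1) tu-unit

mainTheorem19 : (p : ℕ) → Prime p → p ≢ 2 →
    ((∃[ a ] eval K6 a ≡[ p ] + 0) →
      ∃[ as ] PolyEqMod p K6 (scaledProd {6} (+ 2) as))
    × (∀ α → eval K6 α ≡[ p ] + 0 → ¬ (α ≡[ p ] + 0) × ¬ (α ≡[ p ] + 1))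
    × (∀ α β → eval K6 α ≡[ p ] + 0 → eval K6 β ≡[ p ] + 0 →
        ∃[ h ] Applies p h α β)
mainTheorem19 p p-prime p≢2 =
  (λ (a , Ka≡0) → K6-splits p-prime p≢2 a (≡[]⇒≈ Ka≡0)) ,
  (λ α Kα≡0 → K6-root-≉0 p-prime p≢2 α (≡[]⇒≈ Kα≡0) ∘ ≡[]⇒≈ ,
              K6-root-≉1 p-prime p≢2 α (≡[]⇒≈ Kα≡0) ∘ ≡[]⇒≈) ,
  (λ α β Kα≡0 Kβ≡0 → K6-roots-related p-prime p≢2 α β (≡[]⇒≈ Kα≡0) (≡[]⇒≈ Kβ≡0))
  where open Modulo p using (≡[]⇒≈)
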